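{- Let $d$ be a positive square-free integer with $d\equiv 5\pmod 8$, $K=\mathbb{Q}(\sqrt d)$, $\mathcal{O}_K=\mathbb{Z}[\frac{1+\sqrt d}{2}]$. Define integers $P_j, Q_j, q_j$ and elements $\theta_j\in K$ by $P_0=1$, $Q_0=2$, $\theta_1=1$ and, for $j\ge 0$, $q_j=\left\lfloor \frac{P_j+\sqrt d}{Q_j}\right\rfloor$, $P_{j+1}=q_jQ_j-P_j$, $Q_{j+1}=\frac{d-P_{j+1}^2}{Q_j}$, $\theta_{j+2}=\frac{P_{j+1}+\sqrt d}{Q_j}\,\theta_{j+1}$. Then for every $j\ge 1$, $\theta_j\notin 2\mathcal{O}_K$.
   Context: The recursion is the continued-fraction (infrastructure) reduction: $(\theta_1)=\mathcal{O}_K=[\frac{Q_0}{2},\frac{P_0+\sqrt d}{2}]$, and for $j\ge 0$ the element $\theta_{j+2}\in\mathcal{O}_K$ generates the principal $\mathcal{O}_K$-ideal equal to the $\mathbb{Z}$-module $[\frac{Q_{j+1}}{2},\frac{P_{j+1}+\sqrt d}{2}]$, obtained from $(\theta_{j+1})=[\frac{Q_j}{2},\frac{P_j+\sqrt d}{2}]$ by one reduction step; these ideals form the cycle of reduced principal ideals of $\mathcal{O}_K$. Here $2\mathcal{O}_K$ is the ideal generated by $2$ (a prime ideal, since $2$ is inert in $K$). -}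

module Defs where

open import Data.Nat as ℕ using (ℕ)
open import Data.Integer as ℤ using (ℤ; +_)
open import Data.Rational as ℚ using (ℚ; ½)
open import Data.Product using (_×_; _,_; Σ; ∃)
open import Data.Sum using (_⊎_)
open import Relation.Binary.PropositionalEquality using (_≡_)
open import Data.Nat.Divisibility using (_∣_)

SquareFree : ℕ → Set
SquareFree d = ∀ (n : ℕ) → (n ℕ.* n) ∣ d → n ≡ 1

-- Elements of K = ℚ(√d) as pairs (a , b) standing for a + b√d
K : Set
K = ℚ × ℚ

ℤtoℚ : ℤ → ℚ
ℤtoℚ z = z ℚ./ 1

embℤ : ℤ → K
embℤ z = (ℤtoℚ z , ℚ.0ℚ)

oneK : K
oneK = (ℚ.1ℚ , ℚ.0ℚ)

mulK : ℕ → K → K → K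
mulK d (a , b) (c , e) = (a ℚ.* c ℚ.+ ℤtoℚ (+ d) ℚ.* (b ℚ.* e) , a ℚ.* e ℚ.+ b ℚ.* c)

addK : K → K → K
addK (a , b) (c , e) = (a ℚ.+ c , b ℚ.+ e)

ω : K
ω = (½ , ½)

InOK : ℕ → K → Set
InOK d x = Σ ℤ λ m → Σ ℤ λ n → x ≡ addK (embℤ m) (mulK d (embℤ n) ω)

In2OK : ℕ → K → Set
In2OK d x = Σ K λ y → InOK d y × (x ≡ mulK d (embℤ (+ 2)) y)

-- comparisons of an integer x with the real number √d (d ≥ 0)
-- x ≤ √d
LeSqrt : ℕ → ℤ → Set
LeSqrt d x = (x ℤ.≤ + 0) ⊎ (x ℤ.* x ℤ.≤ + d)
LtSqrt : ℕ → ℤ → Set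
LtSqrt d x = (x ℤ.< + 0) ⊎ (x ℤ.* x ℤ.< + d)
SqrtLe : ℕ → ℤ → Set
SqrtLe d x = (+ 0 ℤ.≤ x) × (+ d ℤ.≤ x ℤ.* x)
SqrtLt : ℕ → ℤ → Set
SqrtLt d x = (+ 0 ℤ.< x) × (+ d ℤ.< x ℤ.* x)

-- IsFloor d q P Q  :⇔  q = ⌊(P + √d)/Q⌋, i.e. q ≤ (P+√d)/Q < q+1 (with Q ≠ 0).
-- For Q > 0:  qQ - P ≤ √d < (q+1)Q - P.
-- For Q < 0:  (q+1)Q - P < √d ≤ qQ - P.
IsFloor : ℕ → ℤ → ℤ → ℤ → Set
IsFloor d q P Q =
  ((+ 0 ℤ.< Q) × LeSqrt d (q ℤ.* Q ℤ.- P) × SqrtLt d ((q ℤ.+ + 1) ℤ.* Q ℤ.- P))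
  ⊎ ((Q ℤ.< + 0) × SqrtLe d (q ℤ.* Q ℤ.- P) × LtSqrt d ((q ℤ.+ + 1) ℤ.* Q ℤ.- P))

-- Taking norms in the recursion for θ and using Q_{j+1} Q_j = d - P_{j+1}² gives
-- Q_j N(θ_{j+2}) = -Q_{j+1} N(θ_{j+1}), hence Q_j² = 4 N(θ_{j+1})² for all j.
-- Because d ≡ 5 (mod 8), every Q_j is twice an odd number: if Q_j is even then P_{j+1}
-- must be odd, so d - P_{j+1}² ≡ 4 (mod 8).  On the other hand d ≡ 1 (mod 4) makes the
-- norm of an element of O_K an integer, so elements of 2 O_K have norm divisible by 4.
-- Then θ_{j+1} ∈ 2 O_K would make Q_j / 2 = ± N(θ_{j+1}) both odd and even.
module Submission where

open import Defs
open import Data.Nat as ℕ using (ℕ; suc; _%_; _≤_)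
open import Data.Integer as ℤ using (ℤ; +_)
open import Data.Rational as ℚ using (ℚ)
open import Data.Product using (_×_; _,_)
open import Relation.Binary.PropositionalEquality using (_≡_)
open import Relation.Nullary using (¬_)

open import Data.Nat using (zero; s≤s)
open import Data.Nat.DivMod using (m≡m%n+[m/n]*n)
import Data.Integer.Properties as ℤP
open import Data.List using (_∷_; [])
open import Data.Product using (∃-syntax)
open import Data.Sum using (_⊎_; inj₁; inj₂)
open import Relation.Binary.PropositionalEquality
  using (_≢_; refl; sym; trans; cong; cong₂; subst; module ≡-Reasoning)
open import Relation.Nullary using (contradiction)

module IntegerParity where

  open import Data.Integer using (_+_; _*_; _-_)
  open import Data.Integer.DivMod using (_%ℕ_; _/ℕ_; n%ℕd<d; a≡a%ℕn+[a/ℕn]*n)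
  open import Data.Integer.Divisibility.Signed using (divides; ∣⇒∣ᵤ)
  open import Data.Integer.Tactic.RingSolver using (solve-∀; solve)
  open import Data.Nat.Divisibility using (∣1⇒≡1)

  Even Odd SinglyEven : ℤ → Set
  Even x       = ∃[ b ] x ≡ + 2 * b
  Odd  x       = ∃[ b ] x ≡ + 1 + + 2 * b
  SinglyEven x = ∃[ c ] Odd c × x ≡ + 2 * c

  variable
    x y c h k D P : ℤ

  even⊎odd : ∀ x → Even x ⊎ Odd x
  even⊎odd x with x %ℕ 2 | n%ℕd<d x 2 | a≡a%ℕn+[a/ℕn]*n x 2
  ... | 0 | _ | x≡0+h*2 = inj₁ (x /ℕ 2 , trans x≡0+h*2 (trans (ℤP.+-identityˡ _) (ℤP.*-comm (x /ℕ 2) (+ 2))))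
  ... | 1 | _ | x≡1+h*2 = inj₂ (x /ℕ 2 , trans x≡1+h*2 (cong (_+_ (+ 1)) (ℤP.*-comm (x /ℕ 2) (+ 2))))
  ... | suc (suc _) | s≤s (s≤s ()) | _

  even⇒¬odd : Even x → ¬ Odd x
  even⇒¬odd (a , refl) (b , 2a≡1+2b) with ∣1⇒≡1 (∣⇒∣ᵤ (divides (a - b) 1≡[a-b]*2))
    where
    open ≡-Reasoning
    1≡[a-b]*2 : + 1 ≡ (a - b) * + 2
    1≡[a-b]*2 = begin
      + 1                             ≡⟨ solve (b ∷ []) ⟩
      + 1 + + 2 * b - + 2 * b         ≡⟨ cong (_- + 2 * b) 2a≡1+2b ⟨
      + 2 * a - + 2 * b               ≡⟨ solve (a ∷ b ∷ []) ⟩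
      (a - b) * + 2                   ∎
  ... | ()

  odd*odd : Odd x → Odd y → Odd (x * y)
  odd*odd (a , refl) (b , refl) = a + b + + 2 * a * b , solve (a ∷ b ∷ [])

  even*ˡ : Even x → ∀ y → Even (x * y)
  even*ˡ (a , refl) y = a * y , solve (a ∷ y ∷ [])

  odd*⇒oddˡ : Odd (x * y) → Odd x
  odd*⇒oddˡ {x} {y} xy-odd with even⊎odd x
  ... | inj₁ x-even = contradiction xy-odd (even⇒¬odd (even*ˡ x-even y))
  ... | inj₂ x-odd  = x-odd

  even*odd⇒evenˡ : Even (x * y) → Odd y → Even x
  even*odd⇒evenˡ {x} xy-even y-odd with even⊎odd x
  ... | inj₁ x-even = x-even
  ... | inj₂ x-odd  = contradiction (odd*odd x-odd y-odd) (even⇒¬odd xy-even)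

  b*[b+1]-even : ∀ b → Even (b * (b + + 1))
  b*[b+1]-even b with even⊎odd b
  ... | inj₁ b-even     = even*ˡ b-even (b + + 1)
  ... | inj₂ (c , refl) = (+ 1 + + 2 * c) * (c + + 1) , identity c
    where
    identity : ∀ c → (+ 1 + + 2 * c) * (+ 1 + + 2 * c + + 1) ≡ + 2 * ((+ 1 + + 2 * c) * (c + + 1))
    identity = solve-∀

  odd-square-≡1-mod-8 : Odd x → ∃[ g ] x * x ≡ + 1 + + 8 * g
  odd-square-≡1-mod-8 (b , refl) with b*[b+1]-even b
  ... | (g , b[b+1]≡2g) = g , (begin
    (+ 1 + + 2 * b) * (+ 1 + + 2 * b) ≡⟨ solve (b ∷ []) ⟩
    + 1 + + 4 * (b * (b + + 1))       ≡⟨ cong (λ z → + 1 + + 4 * z) b[b+1]≡2g ⟩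
    + 1 + + 4 * (+ 2 * g)             ≡⟨ solve (g ∷ []) ⟩
    + 1 + + 8 * g                     ∎)
    where open ≡-Reasoning

  even-sub-square⇒odd : Odd D → Even (D - P * P) → Odd P
  even-sub-square⇒odd {D} {P} (a , refl) D-P²-even with even⊎odd P
  ... | inj₂ P-odd      = P-odd
  ... | inj₁ (b , refl) = contradiction (a - + 2 * b * b , identity a b) (even⇒¬odd D-P²-even)
    where
    identity : ∀ a b → + 1 + + 2 * a - + 2 * b * (+ 2 * b) ≡ + 1 + + 2 * (a - + 2 * b * b)
    identity = solve-∀

  ≡5-mod-8⇒sub-odd-square≡4*odd : D ≡ + 5 + + 8 * k → Odd P → ∃[ h ] Odd h × D - P * P ≡ + 4 * h
  ≡5-mod-8⇒sub-odd-square≡4*odd {k = k} {P} refl P-odd with odd-square-≡1-mod-8 P-odd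
  ... | (g , P²≡1+8g) = + 1 + + 2 * (k - g) , (k - g , refl) , (begin
    + 5 + + 8 * k - P * P             ≡⟨ cong (λ z → + 5 + + 8 * k - z) P²≡1+8g ⟩
    + 5 + + 8 * k - (+ 1 + + 8 * g)   ≡⟨ identity k g ⟩
    + 4 * (+ 1 + + 2 * (k - g))       ∎)
    where
    open ≡-Reasoning
    identity : ∀ k g → + 5 + + 8 * k - (+ 1 + + 8 * g) ≡ + 4 * (+ 1 + + 2 * (k - g))
    identity = solve-∀

  *2odd≡4odd⇒singlyEven : Odd c → Odd h → x * (+ 2 * c) ≡ + 4 * h → SinglyEven x
  *2odd≡4odd⇒singlyEven {c} {h} {x} c-odd h-odd x2c≡4h with even*odd⇒evenˡ {x} (h , xc≡2h) c-odd
    where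
    xc≡2h : x * c ≡ + 2 * h
    xc≡2h = ℤP.*-cancelˡ-≡ (+ 2) (x * c) (+ 2 * h) (begin
      + 2 * (x * c)   ≡⟨ solve (x ∷ c ∷ []) ⟩
      x * (+ 2 * c)   ≡⟨ x2c≡4h ⟩
      + 4 * h         ≡⟨ solve (h ∷ []) ⟩
      + 2 * (+ 2 * h) ∎)
      where open ≡-Reasoning
  ... | (s , refl) = s , odd*⇒oddˡ (subst Odd (sym sc≡h) h-odd) , refl
    where
    sc≡h : s * c ≡ h
    sc≡h = ℤP.*-cancelˡ-≡ (+ 4) (s * c) h (begin
      + 4 * (s * c)         ≡⟨ solve (s ∷ c ∷ []) ⟩
      + 2 * s * (+ 2 * c)   ≡⟨ x2c≡4h ⟩
      + 4 * h               ∎)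
      where open ≡-Reasoning

  singlyEven-step : ∀ {Q Q'} → D ≡ + 5 + + 8 * k → SinglyEven Q → Q' * Q ≡ D - P * P → SinglyEven Q'
  singlyEven-step {D} {k} {P} {Q' = Q'} D≡5+8k (c , c-odd , refl) Q'Q≡D-P²
    with ≡5-mod-8⇒sub-odd-square≡4*odd {D} {k} {P} D≡5+8k (even-sub-square⇒odd D-odd D-P²-even)
    where
    D-odd : Odd D
    D-odd = + 2 + + 4 * k , trans D≡5+8k (identity k)
      where
      identity : ∀ k → + 5 + + 8 * k ≡ + 1 + + 2 * (+ 2 + + 4 * k)
      identity = solve-∀
    D-P²-even : Even (D - P * P)
    D-P²-even = Q' * c , trans (sym Q'Q≡D-P²) (identity Q' c)
      where
      identity : ∀ Q' c → Q' * (+ 2 * c) ≡ + 2 * (Q' * c)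
      identity = solve-∀
  ... | (h , h-odd , D-P²≡4h) = *2odd≡4odd⇒singlyEven {x = Q'} c-odd h-odd (trans Q'Q≡D-P² D-P²≡4h)

  singlyEven-square≢4*even-square : SinglyEven x → Even y → x * x ≢ + 4 * (y * y)
  singlyEven-square≢4*even-square {y = y} (c , c-odd , refl) y-even [2c]²≡4y² =
    even⇒¬odd (subst Even (sym c²≡y²) (even*ˡ y-even y)) (odd*odd c-odd c-odd)
    where
    c²≡y² : c * c ≡ y * y
    c²≡y² = ℤP.*-cancelˡ-≡ (+ 4) (c * c) (y * y) (begin
      + 4 * (c * c)           ≡⟨ solve (c ∷ []) ⟩
      + 2 * c * (+ 2 * c)     ≡⟨ [2c]²≡4y² ⟩
      + 4 * (y * y)           ∎)
      where open ≡-Reasoning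

  singlyEven⇒≢0 : SinglyEven x → x ≢ + 0
  singlyEven⇒≢0 x-singlyEven x≡0 =
    singlyEven-square≢4*even-square x-singlyEven (+ 0 , refl) (cong (λ z → z * z) x≡0)

open IntegerParity

module RationalArithmetic where

  open import Data.Rational using (0ℚ; 1ℚ; _+_; _*_; _-_; -_; 1/_; ≢-nonZero; toℚᵘ)
  import Data.Rational.Properties as ℚP
  import Data.Rational.Unnormalised as ℚᵘ
  import Data.Rational.Unnormalised.Properties as ℚᵘP
  import Data.Integer.Tactic.RingSolver as ℤ-Solver
  open import Level using (0ℓ)
  open import Relation.Nullary.Decidable using (dec⇒maybe)
  open import Tactic.RingSolver.Core.AlmostCommutativeRing
    using (AlmostCommutativeRing; fromCommutativeRing)

  ℚ-ring : AlmostCommutativeRing 0ℓ 0ℓ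
  ℚ-ring = fromCommutativeRing ℚP.+-*-commutativeRing (λ x → dec⇒maybe (0ℚ ℚP.≟ x))

  private
    -- ℤtoℚ a = a / 1 unfolds to fromℚᵘ (mkℚᵘ a 0).
    toℚᵘ-ℤtoℚ : ∀ a → toℚᵘ (ℤtoℚ a) ℚᵘ.≃ ℚᵘ.mkℚᵘ a 0
    toℚᵘ-ℤtoℚ a = ℚP.toℚᵘ-fromℚᵘ (ℚᵘ.mkℚᵘ a 0)

  ℤtoℚ-homo-+ : ∀ a b → ℤtoℚ (a ℤ.+ b) ≡ ℤtoℚ a + ℤtoℚ b
  ℤtoℚ-homo-+ a b = ℚP.toℚᵘ-injective (begin
    toℚᵘ (ℤtoℚ (a ℤ.+ b))              ≈⟨ toℚᵘ-ℤtoℚ (a ℤ.+ b) ⟩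
    ℚᵘ.mkℚᵘ (a ℤ.+ b) 0                ≈⟨ ℚᵘ.*≡* (identity a b) ⟩
    ℚᵘ.mkℚᵘ a 0 ℚᵘ.+ ℚᵘ.mkℚᵘ b 0       ≈⟨ ℚᵘP.+-cong (toℚᵘ-ℤtoℚ a) (toℚᵘ-ℤtoℚ b) ⟨
    toℚᵘ (ℤtoℚ a) ℚᵘ.+ toℚᵘ (ℤtoℚ b)   ≈⟨ ℚP.toℚᵘ-homo-+ (ℤtoℚ a) (ℤtoℚ b) ⟨
    toℚᵘ (ℤtoℚ a + ℤtoℚ b)             ∎)
    where
    open ℚᵘP.≃-Reasoning
    identity : ∀ a b → (a ℤ.+ b) ℤ.* + 1 ≡ (a ℤ.* + 1 ℤ.+ b ℤ.* + 1) ℤ.* + 1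
    identity = ℤ-Solver.solve-∀

  ℤtoℚ-homo-* : ∀ a b → ℤtoℚ (a ℤ.* b) ≡ ℤtoℚ a * ℤtoℚ b
  ℤtoℚ-homo-* a b = ℚP.toℚᵘ-injective (begin
    toℚᵘ (ℤtoℚ (a ℤ.* b))              ≈⟨ toℚᵘ-ℤtoℚ (a ℤ.* b) ⟩
    ℚᵘ.mkℚᵘ a 0 ℚᵘ.* ℚᵘ.mkℚᵘ b 0       ≈⟨ ℚᵘP.*-cong (toℚᵘ-ℤtoℚ a) (toℚᵘ-ℤtoℚ b) ⟨
    toℚᵘ (ℤtoℚ a) ℚᵘ.* toℚᵘ (ℤtoℚ b)   ≈⟨ ℚP.toℚᵘ-homo-* (ℤtoℚ a) (ℤtoℚ b) ⟨
    toℚᵘ (ℤtoℚ a * ℤtoℚ b)             ∎)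
    where open ℚᵘP.≃-Reasoning

  ℤtoℚ-homo‿- : ∀ a → ℤtoℚ (ℤ.- a) ≡ - ℤtoℚ a
  ℤtoℚ-homo‿- a = ℚP.toℚᵘ-injective (begin
    toℚᵘ (ℤtoℚ (ℤ.- a))     ≈⟨ toℚᵘ-ℤtoℚ (ℤ.- a) ⟩
    ℚᵘ.- ℚᵘ.mkℚᵘ a 0        ≈⟨ ℚᵘP.-‿cong (toℚᵘ-ℤtoℚ a) ⟨
    ℚᵘ.- toℚᵘ (ℤtoℚ a)      ≈⟨ ℚP.toℚᵘ-homo‿- (ℤtoℚ a) ⟨
    toℚᵘ (- ℤtoℚ a)         ∎)
    where open ℚᵘP.≃-Reasoning

  ℤtoℚ-homo-minus : ∀ a b → ℤtoℚ (a ℤ.- b) ≡ ℤtoℚ a - ℤtoℚ b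
  ℤtoℚ-homo-minus a b = trans (ℤtoℚ-homo-+ a (ℤ.- b)) (cong (_+_ (ℤtoℚ a)) (ℤtoℚ-homo‿- b))

  ℤtoℚ-injective : ∀ {a b} → ℤtoℚ a ≡ ℤtoℚ b → a ≡ b
  ℤtoℚ-injective {a} {b} eq
    with ℚᵘP.≃-trans (ℚᵘP.≃-sym (toℚᵘ-ℤtoℚ a)) (ℚᵘP.≃-trans (ℚP.toℚᵘ-cong eq) (toℚᵘ-ℤtoℚ b))
  ... | ℚᵘ.*≡* a*1≡b*1 = trans (sym (ℤP.*-identityʳ a)) (trans a*1≡b*1 (ℤP.*-identityʳ b))

  *-cancelˡ-≡ : ∀ r {p q} → r ≢ 0ℚ → r * p ≡ r * q → p ≡ q
  *-cancelˡ-≡ r {p} {q} r≢0 rp≡rq = begin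
    p                ≡⟨ ℚP.*-identityˡ p ⟨
    1ℚ * p           ≡⟨ cong (_* p) (ℚP.*-inverseˡ r) ⟨
    1/ r * r * p     ≡⟨ ℚP.*-assoc (1/ r) r p ⟩
    1/ r * (r * p)   ≡⟨ cong (1/ r *_) rp≡rq ⟩
    1/ r * (r * q)   ≡⟨ ℚP.*-assoc (1/ r) r q ⟨
    1/ r * r * q     ≡⟨ cong (_* q) (ℚP.*-inverseˡ r) ⟩
    1ℚ * q           ≡⟨ ℚP.*-identityˡ q ⟩
    q                ∎
    where
    open ≡-Reasoning
    instance _ = ≢-nonZero r≢0

open RationalArithmetic

module NormK where

  open import Data.Rational using (½; 0ℚ; 1ℚ; _+_; _*_; _-_; -_)
  open import Tactic.RingSolver using (solve-∀; solve)

  normK : ℕ → K → ℚ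
  normK d (a , b) = a * a - ℤtoℚ (+ d) * (b * b)

  normK-mulK : ∀ d x y → normK d (mulK d x y) ≡ normK d x * normK d y
  normK-mulK d (a , b) (c , e) = identity (ℤtoℚ (+ d)) a b c e
    where
    identity : ∀ D a b c e →
      (a * c + D * (b * e)) * (a * c + D * (b * e)) - D * ((a * e + b * c) * (a * e + b * c))
        ≡ (a * a - D * (b * b)) * (c * c - D * (e * e))
    identity = solve-∀ ℚ-ring

  normK-embℤ : ∀ d z → normK d (embℤ z) ≡ ℤtoℚ z * ℤtoℚ z
  normK-embℤ d z = identity (ℤtoℚ (+ d)) (ℤtoℚ z)
    where
    identity : ∀ D a → a * a - D * (0ℚ * 0ℚ) ≡ a * a
    identity = solve-∀ ℚ-ring

  normK-oneK : ∀ d → normK d oneK ≡ 1ℚ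
  normK-oneK d = identity (ℤtoℚ (+ d))
    where
    identity : ∀ D → 1ℚ * 1ℚ - D * (0ℚ * 0ℚ) ≡ 1ℚ
    identity = solve-∀ ℚ-ring

  normK-+√d : ∀ d a → normK d (a , 1ℚ) ≡ a * a - ℤtoℚ (+ d)
  normK-+√d d a = identity (ℤtoℚ (+ d)) a
    where
    identity : ∀ D a → a * a - D * (1ℚ * 1ℚ) ≡ a * a - D
    identity = solve-∀ ℚ-ring

  normK-m+nω : ∀ d m n → normK d (addK (embℤ m) (mulK d (embℤ n) ω))
                         ≡ ℤtoℚ m * ℤtoℚ m + ℤtoℚ m * ℤtoℚ n + ½ * ½ * (1ℚ - ℤtoℚ (+ d)) * (ℤtoℚ n * ℤtoℚ n)
  normK-m+nω d m n = identity (ℤtoℚ (+ d)) (ℤtoℚ m) (ℤtoℚ n)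
    where
    identity : ∀ D m n →
      (m + (n * ½ + D * (0ℚ * ½))) * (m + (n * ½ + D * (0ℚ * ½)))
        - D * ((0ℚ + (n * ½ + 0ℚ * ½)) * (0ℚ + (n * ½ + 0ℚ * ½)))
        ≡ m * m + m * n + ½ * ½ * (1ℚ - D) * (n * n)
    identity = solve-∀ ℚ-ring

  normK-InOK : ∀ {d} e {y} → + d ≡ + 1 ℤ.+ + 4 ℤ.* e → InOK d y → ∃[ t ] normK d y ≡ ℤtoℚ t
  normK-InOK {d} e d≡1+4e (m , n , refl) = m ℤ.* m ℤ.+ m ℤ.* n ℤ.- e ℤ.* (n ℤ.* n) , (begin
    normK d (addK (embℤ m) (mulK d (embℤ n) ω))
      ≡⟨ normK-m+nω d m n ⟩
    M * M + M * N + ½ * ½ * (1ℚ - ℤtoℚ (+ d)) * (N * N)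
      ≡⟨ cong (λ D → M * M + M * N + ½ * ½ * (1ℚ - D) * (N * N)) D≡1+4e ⟩
    M * M + M * N + ½ * ½ * (1ℚ - (1ℚ + ℤtoℚ (+ 4) * E)) * (N * N)
      ≡⟨ identity M N E ⟩
    M * M + M * N - E * (N * N)
      ≡⟨ cong₂ _-_ (trans (ℤtoℚ-homo-+ (m ℤ.* m) (m ℤ.* n)) (cong₂ _+_ (ℤtoℚ-homo-* m m) (ℤtoℚ-homo-* m n)))
                   (trans (ℤtoℚ-homo-* e (n ℤ.* n)) (cong (_*_ E) (ℤtoℚ-homo-* n n))) ⟨
    ℤtoℚ (m ℤ.* m ℤ.+ m ℤ.* n) - ℤtoℚ (e ℤ.* (n ℤ.* n))
      ≡⟨ ℤtoℚ-homo-minus (m ℤ.* m ℤ.+ m ℤ.* n) (e ℤ.* (n ℤ.* n)) ⟨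
    ℤtoℚ (m ℤ.* m ℤ.+ m ℤ.* n ℤ.- e ℤ.* (n ℤ.* n)) ∎)
    where
    open ≡-Reasoning
    M = ℤtoℚ m
    N = ℤtoℚ n
    E = ℤtoℚ e
    D≡1+4e : ℤtoℚ (+ d) ≡ 1ℚ + ℤtoℚ (+ 4) * E
    D≡1+4e = trans (cong ℤtoℚ d≡1+4e) (trans (ℤtoℚ-homo-+ (+ 1) (+ 4 ℤ.* e)) (cong (_+_ 1ℚ) (ℤtoℚ-homo-* (+ 4) e)))
    identity : ∀ M N E → M * M + M * N + ½ * ½ * (1ℚ - (1ℚ + ℤtoℚ (+ 4) * E)) * (N * N)
                         ≡ M * M + M * N - E * (N * N)
    identity = solve-∀ ℚ-ring

  normK-In2OK : ∀ {d} e {x} → + d ≡ + 1 ℤ.+ + 4 ℤ.* e → In2OK d x → ∃[ t ] normK d x ≡ ℤtoℚ (+ 4 ℤ.* t)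
  normK-In2OK {d} e d≡1+4e (y , y∈OK , refl) with normK-InOK e d≡1+4e y∈OK
  ... | t , Ny≡t = t , (begin
    normK d (mulK d (embℤ (+ 2)) y)        ≡⟨ normK-mulK d (embℤ (+ 2)) y ⟩
    normK d (embℤ (+ 2)) * normK d y       ≡⟨ cong₂ _*_ (normK-embℤ d (+ 2)) Ny≡t ⟩
    ℤtoℚ (+ 4) * ℤtoℚ t                    ≡⟨ ℤtoℚ-homo-* (+ 4) t ⟨
    ℤtoℚ (+ 4 ℤ.* t)                       ∎)
    where open ≡-Reasoning

  Q²≡4N²-step : ∀ {D q q' p n n'} → q ≢ 0ℚ →
    q * q * n' ≡ (p * p - D) * n → q' * q ≡ D - p * p →
    q * q ≡ ℤtoℚ (+ 4) * (n * n) → q' * q' ≡ ℤtoℚ (+ 4) * (n' * n')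
  Q²≡4N²-step {D} {q} {q'} {p} {n} {n'} q≢0 q²n'≡[p²-D]n q'q≡D-p² q²≡4n² =
    *-cancelˡ-≡ q q≢0 (*-cancelˡ-≡ q q≢0 (begin
      q * (q * (q' * q'))                      ≡⟨ solve (q ∷ q' ∷ []) ℚ-ring ⟩
      q' * q' * (q * q)                        ≡⟨ cong (_*_ (q' * q')) q²≡4n² ⟩
      q' * q' * (ℤtoℚ (+ 4) * (n * n))         ≡⟨ solve (q' ∷ n ∷ []) ℚ-ring ⟩
      ℤtoℚ (+ 4) * (- (q' * n) * - (q' * n))   ≡⟨ cong (λ z → ℤtoℚ (+ 4) * (z * z)) qn'≡-q'n ⟨
      ℤtoℚ (+ 4) * (q * n' * (q * n'))         ≡⟨ solve (q ∷ n' ∷ []) ℚ-ring ⟩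
      q * (q * (ℤtoℚ (+ 4) * (n' * n')))       ∎))
    where
    open ≡-Reasoning
    qn'≡-q'n : q * n' ≡ - (q' * n)
    qn'≡-q'n = *-cancelˡ-≡ q q≢0 (begin
      q * (q * n')          ≡⟨ solve (q ∷ n' ∷ []) ℚ-ring ⟩
      q * q * n'            ≡⟨ q²n'≡[p²-D]n ⟩
      (p * p - D) * n       ≡⟨ solve (p ∷ D ∷ n ∷ []) ℚ-ring ⟩
      - (D - p * p) * n     ≡⟨ cong (λ z → - z * n) q'q≡D-p² ⟨
      - (q' * q) * n        ≡⟨ solve (q' ∷ q ∷ n ∷ []) ℚ-ring ⟩
      q * - (q' * n)        ∎)

open NormK

module Recursion
  (d : ℕ) (k : ℤ) (d≡5+8k : + d ≡ + 5 ℤ.+ + 8 ℤ.* k)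
  (P Q : ℕ → ℤ) (θ : ℕ → K) (Q₀≡2 : Q 0 ≡ + 2) (θ₁≡1 : θ 1 ≡ oneK)
  (Q-rec : ∀ j → Q (suc j) ℤ.* Q j ≡ + d ℤ.- P (suc j) ℤ.* P (suc j))
  (θ-rec : ∀ j → mulK d (embℤ (Q j)) (θ (suc (suc j)))
                 ≡ mulK d (ℤtoℚ (P (suc j)) , ℚ.1ℚ) (θ (suc j)))
  where

  open import Data.Rational using (0ℚ; 1ℚ; _*_; _-_)
  open import Data.Integer.Tactic.RingSolver using (solve-∀)

  N : ℕ → ℚ
  N j = normK d (θ j)

  Q-singlyEven : ∀ j → SinglyEven (Q j)
  Q-singlyEven zero    = + 1 , (+ 0 , refl) , Q₀≡2
  Q-singlyEven (suc j) = singlyEven-step {+ d} {k} {P (suc j)} d≡5+8k (Q-singlyEven j) (Q-rec j)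

  ℤtoℚ-Q≢0 : ∀ j → ℤtoℚ (Q j) ≢ 0ℚ
  ℤtoℚ-Q≢0 j Q≡0 = singlyEven⇒≢0 (Q-singlyEven j) (ℤtoℚ-injective Q≡0)

  Q²≡4N² : ∀ j → ℤtoℚ (Q j) * ℤtoℚ (Q j) ≡ ℤtoℚ (+ 4) * (N (suc j) * N (suc j))
  Q²≡4N² zero = begin
    ℤtoℚ (Q 0) * ℤtoℚ (Q 0)   ≡⟨ cong (λ z → ℤtoℚ z * ℤtoℚ z) Q₀≡2 ⟩
    ℤtoℚ (+ 4) * (1ℚ * 1ℚ)    ≡⟨ cong (λ n → ℤtoℚ (+ 4) * (n * n)) (trans (cong (normK d) θ₁≡1) (normK-oneK d)) ⟨
    ℤtoℚ (+ 4) * (N 1 * N 1)  ∎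
    where open ≡-Reasoning
  Q²≡4N² (suc j) = Q²≡4N²-step {ℤtoℚ (+ d)} {ℤtoℚ (Q j)} {ℤtoℚ (Q (suc j))} {p} {N (suc j)} {N (suc (suc j))}
                     (ℤtoℚ-Q≢0 j) norm-of-θ-rec Q-rec-in-ℚ (Q²≡4N² j)
    where
    open ≡-Reasoning
    p = ℤtoℚ (P (suc j))
    norm-of-θ-rec : ℤtoℚ (Q j) * ℤtoℚ (Q j) * N (suc (suc j)) ≡ (p * p - ℤtoℚ (+ d)) * N (suc j)
    norm-of-θ-rec = begin
      ℤtoℚ (Q j) * ℤtoℚ (Q j) * N (suc (suc j))              ≡⟨ cong (_* N (suc (suc j))) (normK-embℤ d (Q j)) ⟨
      normK d (embℤ (Q j)) * N (suc (suc j))                 ≡⟨ normK-mulK d (embℤ (Q j)) (θ (suc (suc j))) ⟨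
      normK d (mulK d (embℤ (Q j)) (θ (suc (suc j))))        ≡⟨ cong (normK d) (θ-rec j) ⟩
      normK d (mulK d (p , 1ℚ) (θ (suc j)))                  ≡⟨ normK-mulK d (p , 1ℚ) (θ (suc j)) ⟩
      normK d (p , 1ℚ) * N (suc j)                           ≡⟨ cong (_* N (suc j)) (normK-+√d d p) ⟩
      (p * p - ℤtoℚ (+ d)) * N (suc j)                       ∎
    Q-rec-in-ℚ : ℤtoℚ (Q (suc j)) * ℤtoℚ (Q j) ≡ ℤtoℚ (+ d) - p * p
    Q-rec-in-ℚ = begin
      ℤtoℚ (Q (suc j)) * ℤtoℚ (Q j)                 ≡⟨ ℤtoℚ-homo-* (Q (suc j)) (Q j) ⟨
      ℤtoℚ (Q (suc j) ℤ.* Q j)                      ≡⟨ cong ℤtoℚ (Q-rec j) ⟩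
      ℤtoℚ (+ d ℤ.- P (suc j) ℤ.* P (suc j))        ≡⟨ ℤtoℚ-homo-minus (+ d) (P (suc j) ℤ.* P (suc j)) ⟩
      ℤtoℚ (+ d) - ℤtoℚ (P (suc j) ℤ.* P (suc j))   ≡⟨ cong (ℤtoℚ (+ d) -_) (ℤtoℚ-homo-* (P (suc j)) (P (suc j))) ⟩
      ℤtoℚ (+ d) - p * p                            ∎

  θ∉2OK : ∀ j → ¬ In2OK d (θ (suc j))
  θ∉2OK j θ∈2OK with normK-In2OK (+ 1 ℤ.+ + 2 ℤ.* k) (trans d≡5+8k (5+8k≡1+4[1+2k] k)) θ∈2OK
    where
    5+8k≡1+4[1+2k] : ∀ k → + 5 ℤ.+ + 8 ℤ.* k ≡ + 1 ℤ.+ + 4 ℤ.* (+ 1 ℤ.+ + 2 ℤ.* k)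
    5+8k≡1+4[1+2k] = solve-∀
  ... | t , N≡4t = singlyEven-square≢4*even-square (Q-singlyEven j) (+ 2 ℤ.* t , 4t≡2[2t] t)
                     (ℤtoℚ-injective (begin
    ℤtoℚ (Q j ℤ.* Q j)                             ≡⟨ ℤtoℚ-homo-* (Q j) (Q j) ⟩
    ℤtoℚ (Q j) * ℤtoℚ (Q j)                        ≡⟨ Q²≡4N² j ⟩
    ℤtoℚ (+ 4) * (N (suc j) * N (suc j))           ≡⟨ cong (λ n → ℤtoℚ (+ 4) * (n * n)) N≡4t ⟩
    ℤtoℚ (+ 4) * (ℤtoℚ (+ 4 ℤ.* t) * ℤtoℚ (+ 4 ℤ.* t))
      ≡⟨ trans (ℤtoℚ-homo-* (+ 4) ((+ 4 ℤ.* t) ℤ.* (+ 4 ℤ.* t))) (cong (ℤtoℚ (+ 4) *_) (ℤtoℚ-homo-* (+ 4 ℤ.* t) (+ 4 ℤ.* t))) ⟨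
    ℤtoℚ (+ 4 ℤ.* ((+ 4 ℤ.* t) ℤ.* (+ 4 ℤ.* t)))  ∎))
    where
    open ≡-Reasoning
    4t≡2[2t] : ∀ t → + 4 ℤ.* t ≡ + 2 ℤ.* (+ 2 ℤ.* t)
    4t≡2[2t] = solve-∀

m%8≡5⇒m≡5+8[m/8] : ∀ d → d % 8 ≡ 5 → + d ≡ + 5 ℤ.+ + 8 ℤ.* + (d ℕ./ 8)
m%8≡5⇒m≡5+8[m/8] d d%8≡5 = begin
  + d                                 ≡⟨ cong +_ (m≡m%n+[m/n]*n d 8) ⟩
  + (d % 8 ℕ.+ d ℕ./ 8 ℕ.* 8)         ≡⟨ cong (λ r → + (r ℕ.+ d ℕ./ 8 ℕ.* 8)) d%8≡5 ⟩
  + (5 ℕ.+ d ℕ./ 8 ℕ.* 8)             ≡⟨ ℤP.pos-+ 5 (d ℕ./ 8 ℕ.* 8) ⟩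
  + 5 ℤ.+ + (d ℕ./ 8 ℕ.* 8)           ≡⟨ cong (ℤ._+_ (+ 5)) (ℤP.pos-* (d ℕ./ 8) 8) ⟩
  + 5 ℤ.+ + (d ℕ./ 8) ℤ.* + 8         ≡⟨ cong (ℤ._+_ (+ 5)) (ℤP.*-comm (+ (d ℕ./ 8)) (+ 8)) ⟩
  + 5 ℤ.+ + 8 ℤ.* + (d ℕ./ 8)         ∎
  where open ≡-Reasoning

theoremA1 : (d : ℕ) → 0 ℕ.< d → SquareFree d → d % 8 ≡ 5 →
    (P Q q : ℕ → ℤ) (θ : ℕ → K) →
    P 0 ≡ + 1 → Q 0 ≡ + 2 → θ 1 ≡ oneK →
    (∀ j → IsFloor d (q j) (P j) (Q j)) →
    (∀ j → P (suc j) ≡ q j ℤ.* Q j ℤ.- P j) →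
    (∀ j → Q (suc j) ℤ.* Q j ≡ + d ℤ.- P (suc j) ℤ.* P (suc j)) →
    (∀ j → mulK d (embℤ (Q j)) (θ (suc (suc j)))
             ≡ mulK d (ℤtoℚ (P (suc j)) , ℚ.1ℚ) (θ (suc j))) →
    ∀ j → 1 ≤ j → ¬ In2OK d (θ j)
theoremA1 d _ _ d%8≡5 P Q _ θ _ Q₀≡2 θ₁≡1 _ _ Q-rec θ-rec (suc j) _ = θ∉2OK j
  where open Recursion d (+ (d ℕ./ 8)) (m%8≡5⇒m≡5+8[m/8] d d%8≡5) P Q θ Q₀≡2 θ₁≡1 Q-rec θ-rec
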